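{- If $T$ is an in-quadrangular tournament with $\delta^{ - }(T)\geq 2$, then $\delta^{ - }(T)\geq 4$.
   Context: A tournament $T$ is a loopless digraph in which for each pair of distinct vertices exactly one of $(u,v)$, $(v,u)$ is an arc. $I(v)$ is the set of vertices that beat $v$. A digraph is in-quadrangular if $|I(u)\cap I(v)|\neq 1$ for all distinct vertices $u,v$. $\delta^{ - }(T)$ is the minimum in-degree of $T$. -}

module Defs where

open import Data.Nat using (ℕ; zero; suc; _+_; _≤_)
open import Data.Fin using (Fin; zero; suc)
open import Data.Bool using (Bool; true; false; not; _∧_)
open import Relation.Binary.PropositionalEquality using (_≡_; _≢_)

-- A digraph on the vertex set Fin n, given by its arc relation:
-- (u , v) is an arc (u beats v) iff  arc u v ≡ true.
Digraph : ℕ → Set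
Digraph n = Fin n → Fin n → Bool

record IsTournament {n : ℕ} (T : Digraph n) : Set where
  field
    loopless : ∀ u → T u u ≡ false
    exactlyOne : ∀ u v → u ≢ v → T u v ≡ not (T v u)

count : ∀ {n} → (Fin n → Bool) → ℕ
count {zero} p = zero
count {suc n} p = (if p zero then 1 else 0) + count (λ i → p (suc i))
  where
  if_then_else_ : {A : Set} → Bool → A → A → A
  if true then x else y = x
  if false then x else y = y

inDegree : ∀ {n} → Digraph n → Fin n → ℕ
inDegree T v = count (λ w → T w v)

commonIn : ∀ {n} → Digraph n → Fin n → Fin n → ℕ
commonIn T u v = count (λ w → T w u ∧ T w v)

InQuadrangular : ∀ {n} → Digraph n → Set
InQuadrangular T = ∀ u v → u ≢ v → commonIn T u v ≢ 1

MinInDegree≥ : ∀ {n} → Digraph n → ℕ → Set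
MinInDegree≥ T k = ∀ v → k ≤ inDegree T v

{-# OPTIONS --safe #-}
-- If 2 ≤ |I(v)| ≤ 3, the subtournament induced on I(v) has a vertex x of in-degree one:
-- on two vertices this is the head of the arc; on a triangle a, b, c two of the
-- booleans [a→b], [b→c], [c→a] agree by pigeonhole, and the vertex shared by those two
-- arcs is beaten by exactly one of the others. Since I(x) ∩ I(v) is the in-neighbourhood
-- of x inside I(v), this gives |I(x) ∩ I(v)| = 1, which in-quadrangularity forbids.
module Submission where

open import Data.Nat using (ℕ; zero; suc; _≤_; s≤s)
open import Data.Nat.Properties using (≰⇒>)
open import Data.Fin using (Fin; zero; suc)
open import Data.Bool using (Bool; true; false; not; _∧_)
open import Data.Bool.Properties using (T-≡)
open import Data.List using (List; []; _∷_; length; filterᵇ; tabulate; allFin)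
open import Data.List.Membership.Propositional using (_∈_)
open import Data.List.Relation.Unary.Any using (here; there)
open import Data.List.Relation.Unary.AllPairs using ([]; _∷_)
open import Data.List.Relation.Unary.All using ([]; _∷_)
open import Data.List.Relation.Unary.Unique.Propositional using (Unique)
import Data.List.Relation.Unary.Unique.Propositional.Properties as Unique
open import Data.List.Membership.Propositional.Properties using (∈-filter⁻)
open import Data.List.Relation.Binary.Permutation.Propositional using (_↭_; swap; refl; ↭-sym)
open import Data.List.Relation.Binary.Permutation.Propositional.Properties
  using (↭-length; filter-↭; ∈-resp-↭; shift)
open import Data.Product using (_×_; _,_; proj₂; ∃-syntax)
open import Data.Sum using (_⊎_; inj₁; inj₂)
open import Data.Empty using (⊥)
open import Relation.Nullary using (contradiction)
open import Function using (_∘_; id)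
open import Function.Bundles using (Equivalence)
open import Relation.Nullary.Decidable using (T?)
open import Relation.Binary.PropositionalEquality using (_≡_; _≢_; refl; sym; trans; cong; subst; ≢-sym)
open import Defs

elements : ∀ {n} → (Fin n → Bool) → List (Fin n)
elements p = filterᵇ p (allFin _)

count∘≡length-filterᵇ : ∀ {a} {A : Set a} {n} (p : A → Bool) (f : Fin n → A) →
                        count (p ∘ f) ≡ length (filterᵇ p (tabulate f))
count∘≡length-filterᵇ {n = zero}  p f = refl
count∘≡length-filterᵇ {n = suc n} p f with p (f zero)
... | true  = cong suc (count∘≡length-filterᵇ p (f ∘ suc))
... | false = count∘≡length-filterᵇ p (f ∘ suc)

count≡length-elements : ∀ {n} (p : Fin n → Bool) → count p ≡ length (elements p)
count≡length-elements p = count∘≡length-filterᵇ p id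

filterᵇ-∧ : ∀ {a} {A : Set a} (q p : A → Bool) (xs : List A) →
            filterᵇ (λ x → q x ∧ p x) xs ≡ filterᵇ q (filterᵇ p xs)
filterᵇ-∧ q p [] = refl
filterᵇ-∧ q p (x ∷ xs) with p x
... | false with q x
...   | true  = filterᵇ-∧ q p xs
...   | false = filterᵇ-∧ q p xs
filterᵇ-∧ q p (x ∷ xs) | true with q x
...   | true  = cong (x ∷_) (filterᵇ-∧ q p xs)
...   | false = filterᵇ-∧ q p xs

count-∧≡length-filterᵇ-elements : ∀ {n} (q p : Fin n → Bool) →
                                  count (λ x → q x ∧ p x) ≡ length (filterᵇ q (elements p))
count-∧≡length-filterᵇ-elements q p =
  trans (count≡length-elements (λ x → q x ∧ p x)) (cong length (filterᵇ-∧ q p (allFin _)))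

elements-unique : ∀ {n} (p : Fin n → Bool) → Unique (elements p)
elements-unique {n} p = Unique.filter⁺ (T? ∘ p) (Unique.allFin⁺ n)

∈-elements⁻ : ∀ {n} (p : Fin n → Bool) {x} → x ∈ elements p → p x ≡ true
∈-elements⁻ p x∈ = Equivalence.to T-≡ (proj₂ (∈-filter⁻ (T? ∘ p) {xs = allFin _} x∈))

inDegreeWithin : ∀ {n} → Digraph n → List (Fin n) → Fin n → ℕ
inDegreeWithin T xs x = length (filterᵇ (λ w → T w x) xs)

HasInDegreeOneVertex : ∀ {n} → Digraph n → List (Fin n) → Set
HasInDegreeOneVertex T xs = ∃[ x ] x ∈ xs × inDegreeWithin T xs x ≡ 1

module _ {n} (T : Digraph n) where

  inDegreeWithin-↭ : ∀ {xs ys} x → xs ↭ ys → inDegreeWithin T xs x ≡ inDegreeWithin T ys x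
  inDegreeWithin-↭ x xs↭ys = ↭-length (filter-↭ (T? ∘ λ w → T w x) xs↭ys)

  hasInDegreeOneVertex-↭ : ∀ {xs ys} → xs ↭ ys → HasInDegreeOneVertex T xs → HasInDegreeOneVertex T ys
  hasInDegreeOneVertex-↭ xs↭ys (x , x∈xs , d≡1) =
    x , ∈-resp-↭ xs↭ys x∈xs , trans (sym (inDegreeWithin-↭ x xs↭ys)) d≡1

bool-pigeonhole : (p q r : Bool) → p ≡ r ⊎ q ≡ p ⊎ r ≡ q
bool-pigeonhole true  true  _     = inj₂ (inj₁ refl)
bool-pigeonhole false false _     = inj₂ (inj₁ refl)
bool-pigeonhole true  false true  = inj₁ refl
bool-pigeonhole true  false false = inj₂ (inj₂ refl)
bool-pigeonhole false true  false = inj₁ refl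
bool-pigeonhole false true  true  = inj₂ (inj₂ refl)

module _ {n} {T : Digraph n} (tournament : IsTournament T) where
  open IsTournament tournament

  arc-hasInDegreeOneVertex : ∀ {a b} → T a b ≡ true → HasInDegreeOneVertex T (a ∷ b ∷ [])
  arc-hasInDegreeOneVertex {a} {b} ab = b , there (here refl) , inDegree≡1
    where
    inDegree≡1 : inDegreeWithin T (a ∷ b ∷ []) b ≡ 1
    inDegree≡1 rewrite ab | loopless b = refl

  pair-hasInDegreeOneVertex : ∀ {a b} → a ≢ b → HasInDegreeOneVertex T (a ∷ b ∷ [])
  pair-hasInDegreeOneVertex {a} {b} a≢b with T a b in ab
  ... | true  = arc-hasInDegreeOneVertex ab
  ... | false = hasInDegreeOneVertex-↭ T (swap b a refl)
                  (arc-hasInDegreeOneVertex (trans (exactlyOne b a (≢-sym a≢b)) (cong not ab)))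

  -- T a b ≡ T c a says that exactly one of b, c beats a.
  triangle-inDegreeWithin≡1 : ∀ {a b c} → a ≢ b → T a b ≡ T c a → inDegreeWithin T (a ∷ b ∷ c ∷ []) a ≡ 1
  triangle-inDegreeWithin≡1 {a} {b} {c} a≢b ab≡ca
    rewrite loopless a | exactlyOne b a (≢-sym a≢b) with T a b
  ... | true  rewrite sym ab≡ca = refl
  ... | false rewrite sym ab≡ca = refl

  triangle-hasInDegreeOneVertex : ∀ {a b c} → a ≢ b → b ≢ c → c ≢ a →
                                  HasInDegreeOneVertex T (a ∷ b ∷ c ∷ [])
  triangle-hasInDegreeOneVertex {a} {b} {c} a≢b b≢c c≢a with bool-pigeonhole (T a b) (T b c) (T c a)
  ... | inj₁ ab≡ca        = a , here refl , triangle-inDegreeWithin≡1 a≢b ab≡ca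
  ... | inj₂ (inj₁ bc≡ab) = hasInDegreeOneVertex-↭ T (shift a (b ∷ c ∷ []) [])
                              (b , here refl , triangle-inDegreeWithin≡1 b≢c bc≡ab)
  ... | inj₂ (inj₂ ca≡bc) = hasInDegreeOneVertex-↭ T (↭-sym (shift c (a ∷ b ∷ []) []))
                              (c , here refl , triangle-inDegreeWithin≡1 c≢a ca≡bc)

  small-hasInDegreeOneVertex : ∀ {xs} → Unique xs → 2 ≤ length xs → length xs ≤ 3 → HasInDegreeOneVertex T xs
  small-hasInDegreeOneVertex {[]} _ () _
  small-hasInDegreeOneVertex {_ ∷ []} _ (s≤s ()) _
  small-hasInDegreeOneVertex {a ∷ b ∷ []} ((a≢b ∷ []) ∷ _) _ _ = pair-hasInDegreeOneVertex a≢b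
  small-hasInDegreeOneVertex {a ∷ b ∷ c ∷ []} ((a≢b ∷ a≢c ∷ []) ∷ (b≢c ∷ []) ∷ _) _ _ =
    triangle-hasInDegreeOneVertex a≢b b≢c (≢-sym a≢c)
  small-hasInDegreeOneVertex {_ ∷ _ ∷ _ ∷ _ ∷ _} _ _ (s≤s (s≤s (s≤s ())))

  commonIn≡inDegreeWithin : ∀ u v → commonIn T u v ≡ inDegreeWithin T (elements (λ w → T w v)) u
  commonIn≡inDegreeWithin u v = count-∧≡length-filterᵇ-elements (λ w → T w u) (λ w → T w v)

  in-neighbour≢ : ∀ {u v} → T u v ≡ true → u ≢ v
  in-neighbour≢ {u} uv refl = contradiction (trans (sym uv) (loopless u)) λ ()

  inQuadrangular⇒inDegree∉[2,3] : InQuadrangular T → ∀ v → 2 ≤ inDegree T v → inDegree T v ≤ 3 → ⊥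
  inQuadrangular⇒inDegree∉[2,3] quadrangular v 2≤d d≤3 =
    noInDegreeOneVertex (small-hasInDegreeOneVertex (elements-unique I)
                          (subst (2 ≤_) d≡|I| 2≤d) (subst (_≤ 3) d≡|I| d≤3))
    where
    I : Fin n → Bool
    I w = T w v

    d≡|I| : inDegree T v ≡ length (elements I)
    d≡|I| = count≡length-elements I

    noInDegreeOneVertex : HasInDegreeOneVertex T (elements I) → ⊥
    noInDegreeOneVertex (x , x∈I , d≡1) =
      quadrangular x v (in-neighbour≢ (∈-elements⁻ I x∈I)) (trans (commonIn≡inDegreeWithin x v) d≡1)

corollary12 : (n : ℕ) (T : Digraph n) → IsTournament T → InQuadrangular T →
                MinInDegree≥ T 2 → MinInDegree≥ T 4
corollary12 n T tournament quadrangular δ≥2 v =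
  ≰⇒> (inQuadrangular⇒inDegree∉[2,3] tournament quadrangular v (δ≥2 v))
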